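{- Let $L\subseteq\{0,1\}^*$ be a 0-1-symmetric language. Then $\mathcal{G}_L$ is hereditary, i.e., closed under taking induced subgraphs: if $G\in\mathcal{G}_L$ and $A$ is a nonempty subset of the vertex set of $G$, then the induced subgraph $G[A]$ belongs to $\mathcal{G}_L$.
   Context: All graphs are finite, simple, undirected, with nonempty vertex sets, and graph classes are considered up to isomorphism. For $w\in\{0,1\}^*$ let $\widetilde{w}$ be obtained from $w$ by exchanging the letters 0 and 1; a language $L\subseteq\{0,1\}^*$ is 0-1-symmetric if $L=\{\widetilde w : w\in L\}$. For an alphabet $V$ and distinct $u,v\in V$, $h_{u,v}:V^*\to\{0,1\}^*$ is the monoid morphism with $u\mapsto 0$, $v\mapsto 1$ and $x\mapsto\lambda$ (empty word) for all other letters $x$. For a 0-1-symmetric $L$ and a nonempty word $w$ whose set of occurring letters is $V$, $G(L,w)$ is the graph with vertex set $V$ in which distinct $u,v$ are adjacent iff $h_{u,v}(w)\in L$. A graph is $L$-representable if it is isomorphic to some $G(L,w)$, and $\mathcal{G}_L$ denotes the class of all $L$-representable graphs. -}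

module Defs where

open import Data.Nat using (ℕ; _<_)
open import Data.Bool using (Bool; true; false; not)
open import Data.Fin using (Fin; _≟_)
open import Data.List using (List; []; _∷_; map)
open import Data.List.Membership.Propositional using (_∈_)
open import Data.Product using (Σ; _×_; ∃; ∃-syntax)
open import Relation.Binary.PropositionalEquality using (_≡_; _≢_)
open import Relation.Nullary using (¬_; yes; no)
open import Function.Bundles using (_⇔_; _⤖_; Bijection)
open import Function.Definitions using (Injective)
open import Level using (0ℓ; suc)

-- Binary words: false = letter 0, true = letter 1.
Word01 : Set
Word01 = List Bool

Language : Set₁
Language = Word01 → Set

flipWord : Word01 → Word01
flipWord = map not

-- 0-1-symmetric: L = { w~ : w ∈ L }  (flipWord is an involution, so this is
-- equivalent to: w ∈ L iff w~ ∈ L)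
ZeroOneSymmetric : Language → Set
ZeroOneSymmetric L = ∀ w → L w ⇔ L (flipWord w)

record Graph : Set₁ where
  field
    n      : ℕ
    nonempty : 0 < n
    Adj    : Fin n → Fin n → Set
    symm   : ∀ u v → Adj u v → Adj v u
    irrefl : ∀ u → ¬ Adj u u
open Graph public

h : ∀ {m} → Fin m → Fin m → List (Fin m) → Word01
h u v [] = []
h u v (x ∷ w) with x ≟ u
... | yes _ = false ∷ h u v w
... | no _ with x ≟ v
...   | yes _ = true ∷ h u v w
...   | no _ = h u v w

AdjLw : Language → ∀ {m} → List (Fin m) → Fin m → Fin m → Set
AdjLw L w u v = (u ≢ v) × L (h u v w)

Representable : Language → Graph → Set
Representable L G =
  ∃[ m ] Σ (List (Fin m)) λ w →
    (∀ (x : Fin m) → x ∈ w) ×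
    Σ (Fin (n G) ⤖ Fin m) λ f →
      ∀ u v → Adj G u v ⇔ AdjLw L w (Bijection.to f u) (Bijection.to f v)

-- The induced subgraph of G on the (nonempty) image of an injective map
-- ι : Fin k → Fin (n G), k > 0, with vertex set relabelled as Fin k.
induced : (G : Graph) → ∀ k → 0 < k → (ι : Fin k → Fin (n G)) →
          Injective _≡_ _≡_ ι → Graph
induced G k k>0 ι inj = record
  { n = k
  ; nonempty = k>0
  ; Adj = λ i j → Adj G (ι i) (ι j)
  ; symm = λ i j → symm G (ι i) (ι j)
  ; irrefl = λ i → irrefl G (ι i)
  }

{-# OPTIONS --safe #-}
-- Deleting from w every letter outside a vertex set A does not change
-- h_{u,v}(w) for u, v ∈ A, since h_{u,v} erases those letters anyway.
module Submission where

open import Defs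
open import Data.Nat using (ℕ; _<_)
open import Data.Bool using (true; false)
open import Data.Fin using (Fin; _≟_)
open import Data.Fin.Properties using (any?)
open import Data.List using (List; []; _∷_)
open import Data.List.Membership.Propositional using (_∈_)
open import Data.List.Relation.Unary.Any using (here; there)
open import Data.Product using (_,_)
open import Data.Product.Function.NonDependent.Propositional using (_×-⇔_)
open import Function using (_∘_)
open import Function.Bundles using (_⇔_; mk⇔; Bijection)
open import Function.Construct.Composition using (_⇔-∘_)
open import Function.Construct.Identity using (⤖-id)
open import Function.Definitions using (Injective)
open import Relation.Binary.PropositionalEquality using (_≡_; _≢_; refl; sym; trans; cong; subst)
open import Relation.Nullary using (yes; no; contradiction)

h-∷-other : ∀ {m} {u v x : Fin m} (w : List (Fin m)) →
            x ≢ u → x ≢ v → h u v (x ∷ w) ≡ h u v w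
h-∷-other {u = u} {v} {x} w x≢u x≢v with x ≟ u
... | yes x≡u = contradiction x≡u x≢u
... | no _ with x ≟ v
...   | yes x≡v = contradiction x≡v x≢v
...   | no _    = refl

-- The paper's h_A, with the letters of A = image g relabelled along g.
restrict : ∀ {k m} → (Fin k → Fin m) → List (Fin m) → List (Fin k)
restrict g [] = []
restrict g (x ∷ w) with any? (λ i → g i ≟ x)
... | yes (i , _) = i ∷ restrict g w
... | no _        = restrict g w

module _ {k m : ℕ} (g : Fin k → Fin m) (g-injective : Injective _≡_ _≡_ g) where

  h-∷-rename : ∀ {a b i : Fin k} {w′ : List (Fin k)} {w : List (Fin m)} →
               h a b w′ ≡ h (g a) (g b) w → h a b (i ∷ w′) ≡ h (g a) (g b) (g i ∷ w)
  h-∷-rename {a} {b} {i} eq with i ≟ a | g i ≟ g a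
  ... | yes _   | yes _     = cong (false ∷_) eq
  ... | yes i≡a | no gi≢ga  = contradiction (cong g i≡a) gi≢ga
  ... | no i≢a  | yes gi≡ga = contradiction (g-injective gi≡ga) i≢a
  ... | no _    | no _ with i ≟ b | g i ≟ g b
  ...   | yes _   | yes _     = cong (true ∷_) eq
  ...   | yes i≡b | no gi≢gb  = contradiction (cong g i≡b) gi≢gb
  ...   | no i≢b  | yes gi≡gb = contradiction (g-injective gi≡gb) i≢b
  ...   | no _    | no _      = eq

  h-restrict : ∀ (a b : Fin k) (w : List (Fin m)) →
               h a b (restrict g w) ≡ h (g a) (g b) w
  h-restrict a b [] = refl
  h-restrict a b (x ∷ w) with any? (λ i → g i ≟ x)
  ... | yes (i , refl) = h-∷-rename (h-restrict a b w)
  ... | no x∉image     = trans (h-restrict a b w) (sym (h-∷-other w x≢ga x≢gb))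
    where
    x≢ga : x ≢ g a
    x≢ga x≡ga = x∉image (a , sym x≡ga)
    x≢gb : x ≢ g b
    x≢gb x≡gb = x∉image (b , sym x≡gb)

  ∈-restrict : ∀ (i : Fin k) (w : List (Fin m)) → g i ∈ w → i ∈ restrict g w
  ∈-restrict i (x ∷ w) gi∈ with any? (λ j → g j ≟ x)
  ∈-restrict i (x ∷ w) (here gi≡x)  | yes (j , gj≡x) = here (g-injective (trans gi≡x (sym gj≡x)))
  ∈-restrict i (x ∷ w) (there gi∈w) | yes _          = there (∈-restrict i w gi∈w)
  ∈-restrict i (x ∷ w) (here gi≡x)  | no x∉image     = contradiction (i , gi≡x) x∉image
  ∈-restrict i (x ∷ w) (there gi∈w) | no _           = ∈-restrict i w gi∈w

  ≢-injective-⇔ : ∀ {a b : Fin k} → g a ≢ g b ⇔ a ≢ b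
  ≢-injective-⇔ = mk⇔ (λ ga≢gb a≡b → ga≢gb (cong g a≡b))
                      (λ a≢b ga≡gb → a≢b (g-injective ga≡gb))

  AdjLw-restrict : ∀ (L : Language) (w : List (Fin m)) (a b : Fin k) →
                   AdjLw L w (g a) (g b) ⇔ AdjLw L (restrict g w) a b
  AdjLw-restrict L w a b =
    ≢-injective-⇔ ×-⇔ mk⇔ (subst L (sym hw≡)) (subst L hw≡)
    where
    hw≡ : h a b (restrict g w) ≡ h (g a) (g b) w
    hw≡ = h-restrict a b w

mainTheorem1 : (L : Language) → ZeroOneSymmetric L →
    (G : Graph) → Representable L G →
    (k : ℕ) (k>0 : 0 < k) (ι : Fin k → Fin (n G)) (inj : Injective _≡_ _≡_ ι) →
    Representable L (induced G k k>0 ι inj)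
mainTheorem1 L _ G (m , w , w-covers , f , adj⇔) k _ ι ι-injective =
  k , restrict g w , (λ i → ∈-restrict g g-injective i w (w-covers (g i))) , ⤖-id _ ,
  λ a b → AdjLw-restrict g g-injective L w a b ⇔-∘ adj⇔ (ι a) (ι b)
  where
  g : Fin k → Fin m
  g = Bijection.to f ∘ ι
  g-injective : Injective _≡_ _≡_ g
  g-injective = ι-injective ∘ Bijection.injective f
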